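{- Let $n\ge 2$ and let $Q$ be a $2\times 2$ permutation matrix. Then $\mathrm{M}(n,Q)=n^2-n$. Moreover, the unique $n\times n$ strongly $I_2$-forcing $(0,1)$-matrix with $n^2-n$ $1$-entries is $J_n-H_n$, and the unique $n\times n$ strongly $H_2$-forcing $(0,1)$-matrix with $n^2-n$ $1$-entries is $J_n-I_n$.
   Context: All matrices are $(0,1)$-matrices. An $n\times n$ matrix $A$ is strongly $Q$-forcing (for a $k\times k$ matrix $Q$, $n\ge k$) if for every $1$-entry $o$ of $A$ there is a $k\times k$ submatrix of $A$ (any $k$ rows and any $k$ columns, order kept) exactly equal to $Q$ that contains $o$. $\mathrm{M}(n,Q)$ is the maximum number of $1$-entries of an $n\times n$ strongly $Q$-forcing matrix. $J_n$ is the $n\times n$ all-one matrix, $I_n$ the identity matrix, and $H_n$ the $n\times n$ matrix with $1$-entries exactly at $(1,n),(2,n-1),\dots,(n,1)$ and $0$ elsewhere. -}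

module Defs where

open import Data.Nat using (ℕ; _∸_; _+_)
import Data.Nat as ℕ
open import Data.Bool using (Bool; true; false; not; if_then_else_)
open import Data.Fin using (Fin; toℕ; _<_; _≟_)
open import Data.Fin.Permutation using (Permutation′; _⟨$⟩ʳ_)
open import Data.List using (map; allFin)
open import Data.Nat.ListAction using (sum)
open import Data.Product using (Σ; ∃; _×_; ∃-syntax)
open import Relation.Nullary using (does)
open import Relation.Binary.PropositionalEquality using (_≡_)

Matrix : ℕ → ℕ → Set
Matrix m n = Fin m → Fin n → Bool

IsPermutationMatrix : ∀ {k} → Matrix k k → Set
IsPermutationMatrix {k} Q =
  Σ (Permutation′ k) λ σ → ∀ i j → Q i j ≡ does (j ≟ (σ ⟨$⟩ʳ i))

StrictlyIncreasing : ∀ {k n} → (Fin k → Fin n) → Set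
StrictlyIncreasing {k} f = ∀ (a b : Fin k) → a < b → f a < f b

QOccurrenceAt : ∀ {n k} → Matrix n n → Matrix k k → Fin n → Fin n → Set
QOccurrenceAt {n} {k} A Q i j =
  Σ (Fin k → Fin n) λ r → Σ (Fin k → Fin n) λ c →
    StrictlyIncreasing r × StrictlyIncreasing c ×
    (∀ a b → A (r a) (c b) ≡ Q a b) ×
    (∃[ a ] ∃[ b ] (r a ≡ i × c b ≡ j))

StronglyForcing : ∀ {n k} → Matrix k k → Matrix n n → Set
StronglyForcing {n} Q A = ∀ i j → A i j ≡ true → QOccurrenceAt A Q i j

bit : Bool → ℕ
bit b = if b then 1 else 0

ones : ∀ {n} → Matrix n n → ℕ
ones {n} A = sum (map (λ i → sum (map (λ j → bit (A i j)) (allFin n))) (allFin n))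

-- J_n, I_n, H_n (0-indexed: H has ones at i + j = n - 1)
J : ∀ n → Matrix n n
J n i j = true

I : ∀ n → Matrix n n
I n i j = does (i ≟ j)

H : ∀ n → Matrix n n
H n i j = does (toℕ i + toℕ j ℕ.≟ (n ∸ 1))

-- entrywise J_n - B for B ≤ J_n
J-minus : ∀ {n} → Matrix n n → Matrix n n
J-minus B i j = not (B i j)

-- M(n,Q) = m, as a maximum
IsMaxForcing : ∀ {k} → ℕ → Matrix k k → ℕ → Set
IsMaxForcing n Q m =
  (Σ (Matrix n n) λ A → StronglyForcing Q A × ones A ≡ m) ×
  (∀ (A : Matrix n n) → StronglyForcing Q A → ones A ℕ.≤ m)

UniqueExtremal : ∀ {n k} → Matrix k k → ℕ → Matrix n n → Set
UniqueExtremal {n} Q m B =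
  (StronglyForcing Q B × ones B ≡ m) ×
  (∀ (A : Matrix n n) → StronglyForcing Q A → ones A ≡ m → ∀ i j → A i j ≡ B i j)

-- A 1-entry of A lies in a copy of Q, and every row of a permutation matrix Q contains a 0,
-- so every row of A contains a 0 and A has at most n² − n ones. At equality every row i has
-- exactly one 0, in column z i. For Q = I₂ a 1-entry (i, j) with z i < j must be the lower
-- right corner of its copy, so j is the zero column of a row above i; likewise every column
-- left of z i is the zero column of a row below i. These rows are distinct, so counting gives
-- i + z i = n − 1, i.e. A = J − H. For Q = H₂ the roles of the rows swap and counting gives
-- z i = i, i.e. A = J − I. Conversely, a 1-entry of J − H (of J − I) spans a copy of I₂ (of H₂)
-- together with the zeros in its row and its column.

module Submission where

open import Defs
open import Data.Bool using (Bool; true; false; not)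
open import Data.Fin using (Fin; zero; suc; toℕ; fromℕ<; punchIn; punchOut; opposite; _≟_)
open import Data.Fin.Patterns using (0F; 1F)
open import Data.Fin.Properties
  using (toℕ<n; toℕ-fromℕ<; toℕ-injective; injective⇒≤; punchInᵢ≢i; punchIn-punchOut;
         opposite-prop; opposite-involutive)
import Data.Fin.Properties as Fin
open import Data.List using (allFin; map; tabulate)
open import Data.List.Properties using (map-tabulate)
open import Data.Nat using (ℕ; zero; suc; _+_; _*_; _∸_; _≤_; _<_; z≤n; s≤s; s≤s⁻¹; z<s)
import Data.Nat.ListAction as List
open import Data.Nat.Properties hiding (_≟_)
open import Algebra.Properties.CommutativeMonoid.Sum +-0-commutativeMonoid
  using (sum; sum-syntax; sum-remove; sum-cong-≗)
open import Data.Product using (Σ; _×_; _,_; proj₁; proj₂; ∃-syntax)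
import Data.Product as Product
open import Data.Sum using (_⊎_; inj₁; inj₂)
import Data.Sum as Sum
open import Data.Vec.Functional using ([]; _∷_)
open import Function.Bundles using (_⇔_; mk⇔; Injection)
open import Function.Properties.Inverse using (Inverse⇒Injection)
open import Data.Fin.Permutation using (Permutation′; _⟨$⟩ʳ_)
import Data.Fin.Permutation as Permutation
open import Relation.Binary.Definitions using (Tri; tri<; tri≈; tri>)
open import Function using (_∘_; id; case_of_)
open import Function.Definitions using (Injective)
open import Relation.Binary.PropositionalEquality
open import Relation.Nullary using (does; yes; no; contradiction)
open import Relation.Nullary.Decidable using (dec-true; dec-false; does-⇔)
import Data.Nat as ℕ

∑-const : ∀ n c → ∑[ i < n ] c ≡ n * c
∑-const zero    c = refl
∑-const (suc n) c = cong (c +_) (∑-const n c)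

∑-mono-≤ : ∀ {n} {f g : Fin n → ℕ} → (∀ i → f i ≤ g i) → sum f ≤ sum g
∑-mono-≤ {zero}  f≤g = z≤n
∑-mono-≤ {suc n} f≤g = +-mono-≤ (f≤g zero) (∑-mono-≤ (f≤g ∘ suc))

∑-mono-< : ∀ {n} {f g : Fin n → ℕ} → (∀ i → f i ≤ g i) → ∀ k → f k < g k → sum f < sum g
∑-mono-< {suc n} {f} {g} f≤g k fk<gk = begin-strict
  sum f                       ≡⟨ sum-remove {i = k} f ⟩
  f k + sum (f ∘ punchIn k)   <⟨ +-mono-<-≤ fk<gk (∑-mono-≤ (f≤g ∘ punchIn k)) ⟩
  g k + sum (g ∘ punchIn k)   ≡⟨ sum-remove {i = k} g ⟨
  sum g                       ∎
  where open ≤-Reasoning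

sum-tabulate : ∀ {n} (f : Fin n → ℕ) → List.sum (tabulate f) ≡ sum f
sum-tabulate {zero}  f = refl
sum-tabulate {suc n} f = cong (f zero +_) (sum-tabulate (f ∘ suc))

sum-map-allFin : ∀ {n} (f : Fin n → ℕ) → List.sum (map f (allFin n)) ≡ sum f
sum-map-allFin f = trans (cong List.sum (map-tabulate id f)) (sum-tabulate f)

count : ∀ {n} → (Fin n → Bool) → ℕ
count {n} f = sum {n} (bit ∘ f)

ones≡∑count : ∀ {n} (A : Matrix n n) → ones A ≡ ∑[ i < n ] count (A i)
ones≡∑count {n} A = begin
  List.sum (map (λ i → List.sum (map (bit ∘ A i) (allFin n))) (allFin n))
    ≡⟨ sum-map-allFin {n} _ ⟩
  sum (λ i → List.sum (map (bit ∘ A i) (allFin n)))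
    ≡⟨ sum-cong-≗ (λ i → sum-map-allFin (bit ∘ A i)) ⟩
  ∑[ i < n ] count (A i)   ∎
  where open ≡-Reasoning

count-≤ : ∀ {n} (f : Fin n → Bool) → count f ≤ n
count-≤ {zero}  f = z≤n
count-≤ {suc n} f with f zero
... | true  = s≤s (count-≤ (f ∘ suc))
... | false = m≤n⇒m≤1+n (count-≤ (f ∘ suc))

count-all-true : ∀ {n} (f : Fin n → Bool) → (∀ i → f i ≡ true) → count f ≡ n
count-all-true {zero}  f _ = refl
count-all-true {suc n} f t rewrite t zero = cong suc (count-all-true (f ∘ suc) (t ∘ suc))

count-removeAt-false : ∀ {n} (f : Fin (suc n) → Bool) k → f k ≡ false →
  count f ≡ count (f ∘ punchIn k)
count-removeAt-false f k fk =
  trans (sum-remove {i = k} (bit ∘ f)) (cong (λ b → bit b + count (f ∘ punchIn k)) fk)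

count-false-< : ∀ {n} (f : Fin n → Bool) k → f k ≡ false → count f < n
count-false-< {suc n} f k fk = s≤s (begin
  count f                ≡⟨ count-removeAt-false f k fk ⟩
  count (f ∘ punchIn k)  ≤⟨ count-≤ (f ∘ punchIn k) ⟩
  n                      ∎)
  where open ≤-Reasoning

count-two-false-< : ∀ {n} (f : Fin n → Bool) {j k} → j ≢ k → f j ≡ false → f k ≡ false →
  suc (count f) < n
count-two-false-< {suc n} f {j} {k} j≢k fj fk = s≤s (begin-strict
  count f                ≡⟨ count-removeAt-false f j fj ⟩
  count (f ∘ punchIn j)  <⟨ count-false-< (f ∘ punchIn j) (punchOut j≢k)
                              (trans (cong f (punchIn-punchOut j≢k)) fk) ⟩
  n                      ∎)
  where open ≤-Reasoning

count-single-false : ∀ {n} (f : Fin n → Bool) k → (∀ j → f j ≡ not (does (j ≟ k))) →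
  count f ≡ n ∸ 1
count-single-false {suc n} f k f≡ = begin
  count f                ≡⟨ count-removeAt-false f k (trans (f≡ k) (cong not (dec-true (k ≟ k) refl))) ⟩
  count (f ∘ punchIn k)  ≡⟨ count-all-true (f ∘ punchIn k) f∘punchIn≡true ⟩
  n                      ∎
  where
  open ≡-Reasoning
  f∘punchIn≡true : ∀ j → f (punchIn k j) ≡ true
  f∘punchIn≡true j = trans (f≡ (punchIn k j)) (cong not (dec-false (punchIn k j ≟ k) (punchInᵢ≢i k j)))

EveryRowHasZero : ∀ {m n} → Matrix m n → Set
EveryRowHasZero A = ∀ i → ∃[ j ] A i j ≡ false

forcing-preserves-row-zeros : ∀ {n k} {Q : Matrix k k} {A : Matrix n n} →
  EveryRowHasZero Q → StronglyForcing Q A → EveryRowHasZero A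
forcing-preserves-row-zeros {A = A} Q-rowZero forcing i with A i i in Aii
... | false = i , Aii
... | true with forcing i i Aii
...   | r , c , _ , _ , entries , a , _ , refl , _ =
  c (proj₁ (Q-rowZero a)) , trans (entries a _) (proj₂ (Q-rowZero a))

permutationMatrix-rowZeros : ∀ {k} {Q : Matrix (suc (suc k)) (suc (suc k))} →
  IsPermutationMatrix Q → EveryRowHasZero Q
permutationMatrix-rowZeros (σ , Q≡) a =
  punchIn (σ ⟨$⟩ʳ a) 0F , trans (Q≡ a _) (dec-false (_ ≟ _) (punchInᵢ≢i (σ ⟨$⟩ʳ a) 0F))

∑[n∸1]≡n*n∸n : ∀ n → ∑[ i < n ] (n ∸ 1) ≡ n * n ∸ n
∑[n∸1]≡n*n∸n n = begin
  ∑[ i < n ] (n ∸ 1)  ≡⟨ ∑-const n (n ∸ 1) ⟩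
  n * (n ∸ 1)         ≡⟨ *-distribˡ-∸ n n 1 ⟩
  n * n ∸ n * 1       ≡⟨ cong (n * n ∸_) (*-identityʳ n) ⟩
  n * n ∸ n           ∎
  where open ≡-Reasoning

count-row-≤ : ∀ {n} (A : Matrix n n) → EveryRowHasZero A → ∀ i → count (A i) ≤ n ∸ 1
count-row-≤ A rowZero i = ∸-monoˡ-≤ 1 (count-false-< (A i) _ (proj₂ (rowZero i)))

ones-≤ : ∀ {n} (A : Matrix n n) → EveryRowHasZero A → ones A ≤ n * n ∸ n
ones-≤ {n} A rowZero = begin
  ones A                  ≡⟨ ones≡∑count A ⟩
  ∑[ i < n ] count (A i)  ≤⟨ ∑-mono-≤ (count-row-≤ A rowZero) ⟩
  ∑[ i < n ] (n ∸ 1)      ≡⟨ ∑[n∸1]≡n*n∸n n ⟩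
  n * n ∸ n               ∎
  where open ≤-Reasoning

ones-<-two-zeros : ∀ {n} (A : Matrix n n) → EveryRowHasZero A →
  ∀ {i j k} → j ≢ k → A i j ≡ false → A i k ≡ false → ones A < n * n ∸ n
ones-<-two-zeros {n} A rowZero {i} j≢k Aij Aik = begin-strict
  ones A                  ≡⟨ ones≡∑count A ⟩
  ∑[ i < n ] count (A i)  <⟨ ∑-mono-< (count-row-≤ A rowZero) i
                               (∸-monoˡ-< (count-two-false-< (A i) j≢k Aij Aik) (s≤s z≤n)) ⟩
  ∑[ i < n ] (n ∸ 1)      ≡⟨ ∑[n∸1]≡n*n∸n n ⟩
  n * n ∸ n               ∎
  where open ≤-Reasoning

ZerosExactlyAt : ∀ {m n} → Matrix m n → (Fin m → Fin n) → Set
ZerosExactlyAt A z = ∀ i j → A i j ≡ not (does (j ≟ z i))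

module _ {m n} {A : Matrix m n} {z : Fin m → Fin n} (zeros : ZerosExactlyAt A z) where

  zero-at : ∀ {i j} → j ≡ z i → A i j ≡ false
  zero-at {i} {j} j≡zi = trans (zeros i j) (cong not (dec-true (j ≟ z i) j≡zi))

  one-at : ∀ {i j} → j ≢ z i → A i j ≡ true
  one-at {i} {j} j≢zi = trans (zeros i j) (cong not (dec-false (j ≟ z i) j≢zi))

  one⇒≢ : ∀ {i j} → A i j ≡ true → j ≢ z i
  one⇒≢ Aij j≡zi with trans (sym Aij) (zero-at j≡zi)
  ... | ()

  zero⇒≡ : ∀ {i j} → A i j ≡ false → j ≡ z i
  zero⇒≡ {i} {j} Aij with j ≟ z i
  ... | yes j≡zi = j≡zi
  ... | no  j≢zi = contradiction (trans (sym (one-at j≢zi)) Aij) λ ()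

ZerosExactlyAt-unique : ∀ {m n} {A B : Matrix m n} {z z′ : Fin m → Fin n} →
  ZerosExactlyAt A z → ZerosExactlyAt B z′ → (∀ i → z i ≡ z′ i) → ∀ i j → A i j ≡ B i j
ZerosExactlyAt-unique A-zeros B-zeros z≗z′ i j =
  trans (A-zeros i j) (trans (cong (λ c → not (does (j ≟ c))) (z≗z′ i)) (sym (B-zeros i j)))

ones-ZerosExactlyAt : ∀ {n} {A : Matrix n n} {z} → ZerosExactlyAt A z → ones A ≡ n * n ∸ n
ones-ZerosExactlyAt {n} {A} {z} zeros = begin
  ones A                   ≡⟨ ones≡∑count A ⟩
  ∑[ i < n ] count (A i)   ≡⟨ sum-cong-≗ (λ i → count-single-false (A i) (z i) (zeros i)) ⟩
  ∑[ i < n ] (n ∸ 1)       ≡⟨ ∑[n∸1]≡n*n∸n n ⟩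
  n * n ∸ n                ∎
  where open ≡-Reasoning

extremal⇒ZerosExactlyAt : ∀ {n} (A : Matrix n n) → EveryRowHasZero A → ones A ≡ n * n ∸ n →
  ∃[ z ] ZerosExactlyAt A z
extremal⇒ZerosExactlyAt A rowZero extremal = proj₁ ∘ rowZero , entry
  where
  entry : ∀ i j → A i j ≡ not (does (j ≟ proj₁ (rowZero i)))
  entry i j with j ≟ proj₁ (rowZero i)
  ... | yes refl = proj₂ (rowZero i)
  ... | no j≢zi with A i j in Aij
  ...   | true  = refl
  ...   | false =
    contradiction extremal (<⇒≢ (ones-<-two-zeros A rowZero j≢zi Aij (proj₂ (rowZero i))))

occurrence₂ : ∀ {n} {A : Matrix n n} {Q : Matrix 2 2} {r₀ r₁ c₀ c₁ : Fin n} →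
  toℕ r₀ < toℕ r₁ → toℕ c₀ < toℕ c₁ →
  A r₀ c₀ ≡ Q 0F 0F → A r₀ c₁ ≡ Q 0F 1F → A r₁ c₀ ≡ Q 1F 0F → A r₁ c₁ ≡ Q 1F 1F →
  ∀ a b → QOccurrenceAt A Q ((r₀ ∷ r₁ ∷ []) a) ((c₀ ∷ c₁ ∷ []) b)
occurrence₂ {A = A} {Q} {r₀} {r₁} {c₀} {c₁} r₀<r₁ c₀<c₁ e₀₀ e₀₁ e₁₀ e₁₁ a b =
  rows , cols , increasing r₀<r₁ , increasing c₀<c₁ , entries , a , b , refl , refl
  where
  rows cols : Fin 2 → Fin _
  rows = r₀ ∷ r₁ ∷ []
  cols = c₀ ∷ c₁ ∷ []
  increasing : ∀ {x₀ x₁ : Fin _} → toℕ x₀ < toℕ x₁ → StrictlyIncreasing (x₀ ∷ x₁ ∷ [])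
  increasing x₀<x₁ 0F 1F _ = x₀<x₁
  increasing x₀<x₁ 1F 1F (s≤s ())
  entries : ∀ a b → A (rows a) (cols b) ≡ Q a b
  entries 0F 0F = e₀₀
  entries 0F 1F = e₀₁
  entries 1F 0F = e₁₀
  entries 1F 1F = e₁₁

opposite-reverses-< : ∀ {n} {i j : Fin n} → toℕ i < toℕ j → toℕ (opposite j) < toℕ (opposite i)
opposite-reverses-< {n} {i} {j} i<j =
  subst₂ _<_ (sym (opposite-prop j)) (sym (opposite-prop i)) (∸-monoʳ-< (s≤s i<j) (toℕ<n j))

toℕ-+-opposite : ∀ {n} (i : Fin n) → toℕ i + toℕ (opposite i) ≡ n ∸ 1
toℕ-+-opposite {suc n} i = trans (cong (toℕ i +_) (opposite-prop i)) (m+[n∸m]≡n (s≤s⁻¹ (toℕ<n i)))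

antidiagonal⇔opposite : ∀ {n} (i j : Fin n) → toℕ i + toℕ j ≡ n ∸ 1 ⇔ j ≡ opposite i
antidiagonal⇔opposite i j = mk⇔
  (λ i+j≡n-1 → toℕ-injective (+-cancelˡ-≡ (toℕ i) _ _ (trans i+j≡n-1 (sym (toℕ-+-opposite i)))))
  (λ { refl → toℕ-+-opposite i })

H≡does-opposite : ∀ n (i j : Fin n) → H n i j ≡ does (j ≟ opposite i)
H≡does-opposite n i j =
  does-⇔ (antidiagonal⇔opposite i j) (toℕ i + toℕ j ℕ.≟ n ∸ 1) (j ≟ opposite i)

I≡does-id : ∀ n (i j : Fin n) → I n i j ≡ does (j ≟ i)
I≡does-id n i j = does-⇔ (mk⇔ sym sym) (i ≟ j) (j ≟ i)

J-minus-H-zeros : ∀ n → ZerosExactlyAt (J-minus (H n)) opposite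
J-minus-H-zeros n i j = cong not (H≡does-opposite n i j)

J-minus-I-zeros : ∀ n → ZerosExactlyAt (J-minus (I n)) id
J-minus-I-zeros n i j = cong not (I≡does-id n i j)

antidiagonal-zeros-forcing : ∀ {n} {A : Matrix n n} → ZerosExactlyAt A opposite → StronglyForcing (I 2) A
antidiagonal-zeros-forcing {A = A} zeros i j Aij = occurrence (Fin.<-cmp j (opposite i))
  where
  A-i-i′ : A i (opposite i) ≡ false
  A-i-i′ = zero-at zeros refl
  A-j′-j : A (opposite j) j ≡ false
  A-j′-j = zero-at zeros (sym (opposite-involutive j))
  A-j′-i′ : A (opposite j) (opposite i) ≡ true
  A-j′-i′ = one-at zeros λ i′≡j″ → one⇒≢ zeros Aij (sym (trans i′≡j″ (opposite-involutive j)))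
  occurrence : Tri (toℕ j < toℕ (opposite i)) (j ≡ opposite i) (toℕ (opposite i) < toℕ j) →
    QOccurrenceAt A (I 2) i j
  occurrence (tri≈ _ j≡i′ _) = contradiction j≡i′ (one⇒≢ zeros Aij)
  occurrence (tri< j<i′ _ _) = occurrence₂ i<j′ j<i′ Aij A-i-i′ A-j′-j A-j′-i′ 0F 0F
    where
    i<j′ : toℕ i < toℕ (opposite j)
    i<j′ = subst (λ k → toℕ k < toℕ (opposite j)) (opposite-involutive i) (opposite-reverses-< j<i′)
  occurrence (tri> _ _ i′<j) = occurrence₂ j′<i i′<j A-j′-i′ A-j′-j A-i-i′ Aij 1F 1F
    where
    j′<i : toℕ (opposite j) < toℕ i
    j′<i = subst (λ k → toℕ (opposite j) < toℕ k) (opposite-involutive i) (opposite-reverses-< i′<j)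

diagonal-zeros-forcing : ∀ {n} {A : Matrix n n} → ZerosExactlyAt A id → StronglyForcing (H 2) A
diagonal-zeros-forcing {A = A} zeros i j Aij = occurrence (Fin.<-cmp i j)
  where
  A-i-i : A i i ≡ false
  A-i-i = zero-at zeros refl
  A-j-j : A j j ≡ false
  A-j-j = zero-at zeros refl
  A-j-i : A j i ≡ true
  A-j-i = one-at zeros (one⇒≢ zeros Aij ∘ sym)
  occurrence : Tri (toℕ i < toℕ j) (i ≡ j) (toℕ j < toℕ i) → QOccurrenceAt A (H 2) i j
  occurrence (tri≈ _ i≡j _) = contradiction (sym i≡j) (one⇒≢ zeros Aij)
  occurrence (tri< i<j _ _) = occurrence₂ i<j i<j A-i-i Aij A-j-i A-j-j 0F 1F
  occurrence (tri> _ _ j<i) = occurrence₂ j<i j<i A-j-j A-j-i Aij A-i-i 1F 0F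

injective-into-interval : ∀ {k n lo hi} (f : Fin k → Fin n) → Injective _≡_ _≡_ f →
  (∀ x → lo ≤ toℕ (f x) × toℕ (f x) < hi) → k ≤ hi ∸ lo
injective-into-interval {k} {lo = lo} {hi} f f-injective f∈ = injective⇒≤ shift-injective
  where
  shift : Fin k → Fin (hi ∸ lo)
  shift x = fromℕ< (∸-monoˡ-< (proj₂ (f∈ x)) (proj₁ (f∈ x)))
  shift-injective : Injective _≡_ _≡_ shift
  shift-injective {x} {y} shift≡ = f-injective (toℕ-injective
    (∸-cancelʳ-≡ (proj₁ (f∈ x)) (proj₁ (f∈ y))
      (trans (sym (toℕ-fromℕ< _)) (trans (cong toℕ shift≡) (toℕ-fromℕ< _)))))

m≤n⇒o<n∸m⇒m+o<n : ∀ {m n o} → m ≤ n → o < n ∸ m → m + o < n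
m≤n⇒o<n∸m⇒m+o<n {m} {n} {o} m≤n o<n∸m =
  subst (_≤ n) (trans (+-comm (suc o) m) (+-suc m o)) (m≤o∸n⇒m+n≤o (suc o) m≤n o<n∸m)

covered-interval-≤ : ∀ {m n lo hi lo′ hi′} (z : Fin m → Fin n) → lo ≤ hi → hi ≤ n →
  (∀ j → lo ≤ toℕ j → toℕ j < hi → ∃[ i ] (lo′ ≤ toℕ i × toℕ i < hi′) × z i ≡ j) →
  hi ∸ lo ≤ hi′ ∸ lo′
covered-interval-≤ {lo = lo} {hi} z lo≤hi hi≤n cover =
  injective-into-interval (proj₁ ∘ preimage) preimage-injective (proj₁ ∘ proj₂ ∘ preimage)
  where
  column : Fin (hi ∸ lo) → Fin _
  column x = fromℕ< (≤-trans (m≤n⇒o<n∸m⇒m+o<n lo≤hi (toℕ<n x)) hi≤n)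
  toℕ-column : ∀ x → toℕ (column x) ≡ lo + toℕ x
  toℕ-column x = toℕ-fromℕ< _
  preimage : ∀ x → ∃[ i ] (_ ≤ toℕ i × toℕ i < _) × z i ≡ column x
  preimage x = cover (column x)
    (subst (lo ≤_) (sym (toℕ-column x)) (m≤m+n lo (toℕ x)))
    (subst (_< hi) (sym (toℕ-column x)) (m≤n⇒o<n∸m⇒m+o<n lo≤hi (toℕ<n x)))
  preimage-injective : Injective _≡_ _≡_ (proj₁ ∘ preimage)
  preimage-injective {x} {y} i≡ = toℕ-injective (+-cancelˡ-≡ lo _ _ (begin
    lo + toℕ x           ≡⟨ toℕ-column x ⟨
    toℕ (column x)       ≡⟨ cong toℕ (proj₂ (proj₂ (preimage x))) ⟨
    toℕ (z (proj₁ (preimage x)))  ≡⟨ cong (toℕ ∘ z) i≡ ⟩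
    toℕ (z (proj₁ (preimage y)))  ≡⟨ cong toℕ (proj₂ (proj₂ (preimage y))) ⟩
    toℕ (column y)       ≡⟨ toℕ-column y ⟩
    lo + toℕ y           ∎))
    where open ≡-Reasoning

columns-after-covered : ∀ {m n lo′ hi′} (z : Fin m → Fin n) (c : Fin n) →
  (∀ j → toℕ c < toℕ j → ∃[ i ] (lo′ ≤ toℕ i × toℕ i < hi′) × z i ≡ j) →
  n ∸ suc (toℕ c) ≤ hi′ ∸ lo′
columns-after-covered z c cover = covered-interval-≤ z (toℕ<n c) ≤-refl (λ j c<j _ → cover j c<j)

columns-before-covered : ∀ {m n lo′ hi′} (z : Fin m → Fin n) (c : Fin n) →
  (∀ j → toℕ j < toℕ c → ∃[ i ] (lo′ ≤ toℕ i × toℕ i < hi′) × z i ≡ j) →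
  toℕ c ≤ hi′ ∸ lo′
columns-before-covered z c cover =
  covered-interval-≤ z z≤n (<⇒≤ (toℕ<n c)) (λ j _ j<c → cover j j<c)

m∸[1+n]≤o⇒m∸[1+o]≤n : ∀ m n o → m ∸ suc n ≤ o → m ∸ suc o ≤ n
m∸[1+n]≤o⇒m∸[1+o]≤n m n o m∸[1+n]≤o = m≤n+o⇒m∸n≤o m (suc o) (begin
  m                    ≤⟨ m≤n+m∸n m (suc n) ⟩
  suc n + (m ∸ suc n)  ≤⟨ +-monoʳ-≤ (suc n) m∸[1+n]≤o ⟩
  suc (n + o)          ≡⟨ cong suc (+-comm n o) ⟩
  suc o + n            ∎)
  where open ≤-Reasoning

module _ {n} {A : Matrix n n} {z : Fin n → Fin n} (zeros : ZerosExactlyAt A z) where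

  I₂-occurrence-zeros : ∀ {i j} → A i j ≡ true → QOccurrenceAt A (I 2) i j →
    (toℕ j < toℕ (z i) × ∃[ i′ ] toℕ i < toℕ i′ × z i′ ≡ j) ⊎
    (toℕ (z i) < toℕ j × ∃[ i′ ] toℕ i′ < toℕ i × z i′ ≡ j)
  I₂-occurrence-zeros Aij (r , c , r↑ , c↑ , entries , 0F , 0F , refl , refl) =
    inj₁ (subst (λ k → toℕ (c 0F) < toℕ k) (zero⇒≡ zeros (entries 0F 1F)) (c↑ 0F 1F z<s) ,
          r 1F , r↑ 0F 1F z<s , sym (zero⇒≡ zeros (entries 1F 0F)))
  I₂-occurrence-zeros Aij (r , c , r↑ , c↑ , entries , 1F , 1F , refl , refl) =
    inj₂ (subst (λ k → toℕ k < toℕ (c 1F)) (zero⇒≡ zeros (entries 1F 0F)) (c↑ 0F 1F z<s) ,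
          r 0F , r↑ 0F 1F z<s , sym (zero⇒≡ zeros (entries 0F 1F)))
  I₂-occurrence-zeros Aij (r , c , r↑ , c↑ , entries , 0F , 1F , refl , refl) =
    contradiction (trans (sym Aij) (entries 0F 1F)) λ ()
  I₂-occurrence-zeros Aij (r , c , r↑ , c↑ , entries , 1F , 0F , refl , refl) =
    contradiction (trans (sym Aij) (entries 1F 0F)) λ ()

  H₂-occurrence-zeros : ∀ {i j} → A i j ≡ true → QOccurrenceAt A (H 2) i j →
    (toℕ (z i) < toℕ j × ∃[ i′ ] toℕ i < toℕ i′ × z i′ ≡ j) ⊎
    (toℕ j < toℕ (z i) × ∃[ i′ ] toℕ i′ < toℕ i × z i′ ≡ j)
  H₂-occurrence-zeros Aij (r , c , r↑ , c↑ , entries , 0F , 1F , refl , refl) =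
    inj₁ (subst (λ k → toℕ k < toℕ (c 1F)) (zero⇒≡ zeros (entries 0F 0F)) (c↑ 0F 1F z<s) ,
          r 1F , r↑ 0F 1F z<s , sym (zero⇒≡ zeros (entries 1F 1F)))
  H₂-occurrence-zeros Aij (r , c , r↑ , c↑ , entries , 1F , 0F , refl , refl) =
    inj₂ (subst (λ k → toℕ (c 0F) < toℕ k) (zero⇒≡ zeros (entries 1F 1F)) (c↑ 0F 1F z<s) ,
          r 0F , r↑ 0F 1F z<s , sym (zero⇒≡ zeros (entries 0F 0F)))
  H₂-occurrence-zeros Aij (r , c , r↑ , c↑ , entries , 0F , 0F , refl , refl) =
    contradiction (trans (sym Aij) (entries 0F 0F)) λ ()
  H₂-occurrence-zeros Aij (r , c , r↑ , c↑ , entries , 1F , 1F , refl , refl) =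
    contradiction (trans (sym Aij) (entries 1F 1F)) λ ()

  I₂-forcing-zeros-antidiagonal : StronglyForcing (I 2) A → ∀ i → z i ≡ opposite i
  I₂-forcing-zeros-antidiagonal forcing i =
    toℕ-injective (trans (≤-antisym before (m∸[1+n]≤o⇒m∸[1+o]≤n n (toℕ (z i)) (toℕ i) after))
                         (sym (opposite-prop i)))
    where
    zero-elsewhere : ∀ {j} → j ≢ z i → _
    zero-elsewhere j≢zi = I₂-occurrence-zeros (one-at zeros j≢zi) (forcing i _ (one-at zeros j≢zi))
    after : n ∸ suc (toℕ (z i)) ≤ toℕ i
    after = columns-after-covered z (z i) λ j zi<j → case zero-elsewhere (Fin.<⇒≢ zi<j ∘ sym) of λ where
      (inj₁ (j<zi , _)) → contradiction j<zi (<-asym zi<j)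
      (inj₂ (_ , i′ , i′<i , zi′≡j)) → i′ , (z≤n , i′<i) , zi′≡j
    before : toℕ (z i) ≤ n ∸ suc (toℕ i)
    before = columns-before-covered z (z i) λ j j<zi → case zero-elsewhere (Fin.<⇒≢ j<zi) of λ where
      (inj₁ (_ , i′ , i<i′ , zi′≡j)) → i′ , (i<i′ , toℕ<n i′) , zi′≡j
      (inj₂ (zi<j , _)) → contradiction zi<j (<-asym j<zi)

  H₂-forcing-zeros-diagonal : StronglyForcing (H 2) A → ∀ i → z i ≡ i
  H₂-forcing-zeros-diagonal forcing i =
    toℕ-injective (≤-antisym before (s≤s⁻¹ (∸-cancelʳ-≤ (toℕ<n i) after)))
    where
    zero-elsewhere : ∀ {j} → j ≢ z i → _
    zero-elsewhere j≢zi = H₂-occurrence-zeros (one-at zeros j≢zi) (forcing i _ (one-at zeros j≢zi))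
    after : n ∸ suc (toℕ (z i)) ≤ n ∸ suc (toℕ i)
    after = columns-after-covered z (z i) λ j zi<j → case zero-elsewhere (Fin.<⇒≢ zi<j ∘ sym) of λ where
      (inj₁ (_ , i′ , i<i′ , zi′≡j)) → i′ , (i<i′ , toℕ<n i′) , zi′≡j
      (inj₂ (j<zi , _)) → contradiction j<zi (<-asym zi<j)
    before : toℕ (z i) ≤ toℕ i
    before = columns-before-covered z (z i) λ j j<zi → case zero-elsewhere (Fin.<⇒≢ j<zi) of λ where
      (inj₁ (zi<j , _)) → contradiction zi<j (<-asym j<zi)
      (inj₂ (_ , i′ , i′<i , zi′≡j)) → i′ , (z≤n , i′<i) , zi′≡j

permutation₂ : (σ : Permutation′ 2) → (∀ a → σ ⟨$⟩ʳ a ≡ a) ⊎ (∀ a → σ ⟨$⟩ʳ a ≡ opposite a)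
permutation₂ σ with σ ⟨$⟩ʳ 0F in σ0 | σ ⟨$⟩ʳ 1F in σ1
... | 0F | 1F = inj₁ λ where 0F → σ0 ; 1F → σ1
... | 1F | 0F = inj₂ λ where 0F → σ0 ; 1F → σ1
... | 0F | 0F = contradiction (σ-injective (trans σ0 (sym σ1))) λ ()
  where open Injection (Inverse⇒Injection σ) renaming (injective to σ-injective)
... | 1F | 1F = contradiction (σ-injective (trans σ0 (sym σ1))) λ ()
  where open Injection (Inverse⇒Injection σ) renaming (injective to σ-injective)

I-isPermutationMatrix : ∀ n → IsPermutationMatrix (I n)
I-isPermutationMatrix n = Permutation.id , I≡does-id n

H-isPermutationMatrix : ∀ n → IsPermutationMatrix (H n)
H-isPermutationMatrix n = Permutation.reverse , H≡does-opposite n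

permutationMatrix₂ : ∀ {Q : Matrix 2 2} → IsPermutationMatrix Q →
  (∀ a b → I 2 a b ≡ Q a b) ⊎ (∀ a b → H 2 a b ≡ Q a b)
permutationMatrix₂ {Q} (σ , Q≡) =
  Sum.map (same-permutation id (I≡does-id 2)) (same-permutation opposite (H≡does-opposite 2))
          (permutation₂ σ)
  where
  same-permutation : ∀ {P : Matrix 2 2} (π : Fin 2 → Fin 2) → (∀ a b → P a b ≡ does (b ≟ π a)) →
    (∀ a → σ ⟨$⟩ʳ a ≡ π a) → ∀ a b → P a b ≡ Q a b
  same-permutation π P≡ σ≗π a b =
    trans (P≡ a b) (sym (trans (Q≡ a b) (cong (λ s → does (b ≟ s)) (σ≗π a))))

StronglyForcing-cong : ∀ {n k} {Q Q′ : Matrix k k} {A : Matrix n n} →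
  (∀ a b → Q a b ≡ Q′ a b) → StronglyForcing Q A → StronglyForcing Q′ A
StronglyForcing-cong Q≗Q′ forcing i j Aij with forcing i j Aij
... | r , c , r↑ , c↑ , entries , contains =
  r , c , r↑ , c↑ , (λ a b → trans (entries a b) (Q≗Q′ a b)) , contains

J-minus-H-uniqueExtremal : ∀ n → UniqueExtremal (I 2) (n * n ∸ n) (J-minus (H n))
J-minus-H-uniqueExtremal n =
  (antidiagonal-zeros-forcing (J-minus-H-zeros n) , ones-ZerosExactlyAt (J-minus-H-zeros n)) ,
  λ A forcing extremal →
    let _ , zeros = extremal⇒ZerosExactlyAt A (forcing-preserves-row-zeros I₂-rowZeros forcing) extremal
    in ZerosExactlyAt-unique zeros (J-minus-H-zeros n) (I₂-forcing-zeros-antidiagonal zeros forcing)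
  where I₂-rowZeros = permutationMatrix-rowZeros (I-isPermutationMatrix 2)

J-minus-I-uniqueExtremal : ∀ n → UniqueExtremal (H 2) (n * n ∸ n) (J-minus (I n))
J-minus-I-uniqueExtremal n =
  (diagonal-zeros-forcing (J-minus-I-zeros n) , ones-ZerosExactlyAt (J-minus-I-zeros n)) ,
  λ A forcing extremal →
    let _ , zeros = extremal⇒ZerosExactlyAt A (forcing-preserves-row-zeros H₂-rowZeros forcing) extremal
    in ZerosExactlyAt-unique zeros (J-minus-I-zeros n) (H₂-forcing-zeros-diagonal zeros forcing)
  where H₂-rowZeros = permutationMatrix-rowZeros (H-isPermutationMatrix 2)

permutationMatrix₂-maxForcing : ∀ n {Q : Matrix 2 2} → IsPermutationMatrix Q →
  IsMaxForcing n Q (n * n ∸ n)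
permutationMatrix₂-maxForcing n {Q} Q-perm =
  extremal (permutationMatrix₂ Q-perm) ,
  λ A forcing → ones-≤ A (forcing-preserves-row-zeros (permutationMatrix-rowZeros Q-perm) forcing)
  where
  extremal : (∀ a b → I 2 a b ≡ Q a b) ⊎ (∀ a b → H 2 a b ≡ Q a b) →
    Σ (Matrix n n) λ A → StronglyForcing Q A × ones A ≡ n * n ∸ n
  extremal (inj₁ I₂≗Q) =
    J-minus (H n) , Product.map₁ (StronglyForcing-cong I₂≗Q) (proj₁ (J-minus-H-uniqueExtremal n))
  extremal (inj₂ H₂≗Q) =
    J-minus (I n) , Product.map₁ (StronglyForcing-cong H₂≗Q) (proj₁ (J-minus-I-uniqueExtremal n))

lemma5 : (n : ℕ) → 2 ≤ n →
    (∀ (Q : Matrix 2 2) → IsPermutationMatrix Q → IsMaxForcing n Q (n * n ∸ n)) ×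
    UniqueExtremal (I 2) (n * n ∸ n) (J-minus (H n)) ×
    UniqueExtremal (H 2) (n * n ∸ n) (J-minus (I n))
lemma5 n _ =
  (λ Q → permutationMatrix₂-maxForcing n) , J-minus-H-uniqueExtremal n , J-minus-I-uniqueExtremal n
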